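{- Let $P$ be the ordered bipartite graph with $U(P)=\{a_1<a_2<a_3\}$, $V(P)=\{b_1<b_2<b_3<b_4\}$ and edge set $\{a_1b_1,a_1b_3,a_2b_1,a_2b_4,a_3b_2,a_3b_4\}$. For every positive integer $n$ there is an ordered bipartite graph $G$ avoiding $P$ with $|U(G)|=|V(G)|=n$ and $d_G(u)=\lfloor ex_2(n,P)/(2n)\rfloor$ for every $u\in U(G)$.
   Context: An ordered bipartite graph is a tuple $G=(U,<_U,V,<_V,E)$ with $U,V$ disjoint linearly ordered vertex sets and $E\subseteq U\times V$. $G$ contains an ordered bipartite graph $P$ if there are injective order-preserving maps $U(P)\to U(G)$, $V(P)\to V(G)$ sending edges of $P$ to edges of $G$; otherwise $G$ avoids $P$. $ex_2(n,P)$ is the maximum number of edges of an ordered bipartite graph $G$ with $|U(G)|=|V(G)|=n$ avoiding $P$. -}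

module Defs where

open import Data.Bool using (Bool; true; false; if_then_else_)
open import Data.Nat using (ℕ; zero; suc; _≤_)
open import Data.Fin using (Fin; zero; suc; _<_)
open import Data.List using (map; allFin)
open import Data.Nat.ListAction using (sum)
open import Data.Product using (Σ; _×_; ∃)
open import Relation.Binary.PropositionalEquality using (_≡_)
open import Relation.Nullary using (¬_)

-- Since every finite
-- linear order of size m is isomorphic to Fin m with its usual order,
-- we take U = Fin m, V = Fin k (ordered by Fin's _<_), and the edge set
-- E ⊆ U × V is given by its (decidable) characteristic function.
OBG : ℕ → ℕ → Set
OBG m k = Fin m → Fin k → Bool

StrictlyIncreasing : {p q : ℕ} → (Fin p → Fin q) → Set
StrictlyIncreasing f = ∀ i j → i < j → f i < f j

Contains : {m k p q : ℕ} → OBG m k → OBG p q → Set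
Contains {p = p} {q = q} G P =
  Σ (Fin p → Fin _) λ f → Σ (Fin q → Fin _) λ g →
    StrictlyIncreasing f × StrictlyIncreasing g ×
    (∀ i j → P i j ≡ true → G (f i) (g j) ≡ true)

Avoids : {m k p q : ℕ} → OBG m k → OBG p q → Set
Avoids G P = ¬ Contains G P

degU : {m k : ℕ} → OBG m k → Fin m → ℕ
degU {k = k} G u = sum (map (λ v → if G u v then 1 else 0) (allFin k))

edgeCount : {m k : ℕ} → OBG m k → ℕ
edgeCount {m = m} G = sum (map (degU G) (allFin m))

IsEx2 : {p q : ℕ} → ℕ → OBG p q → ℕ → Set
IsEx2 n P e =
  (∃ λ (G : OBG n n) → Avoids G P × edgeCount G ≡ e) ×
  (∀ (G : OBG n n) → Avoids G P → edgeCount G ≤ e)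

-- The pattern P of Lemma 4.3:
-- U(P) = {a1<a2<a3} (= Fin 3), V(P) = {b1<b2<b3<b4} (= Fin 4),
-- E = {a1b1, a1b3, a2b1, a2b4, a3b2, a3b4}  (0-indexed below).
P43 : OBG 3 4
P43 zero zero = true
P43 zero (suc (suc zero)) = true
P43 (suc zero) zero = true
P43 (suc zero) (suc (suc (suc zero))) = true
P43 (suc (suc zero)) (suc zero) = true
P43 (suc (suc zero)) (suc (suc (suc zero))) = true
P43 _ _ = false

module Submission where

-- Proof idea (vertex splitting).  Let G₀ be an extremal P-free graph, so
-- e(G₀) = e = ex₂(n,P), and put d = ⌊e/(2n)⌋.  If d = 0 the empty graph works.
-- Otherwise cut the neighbourhood of every u ∈ U(G₀) into ⌊deg(u)/d⌋ pairwise
-- disjoint chunks of exactly d vertices ("the first d neighbours, the next d,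
-- ..."), and list the chunks ordered by their vertex u.  Each chunk becomes a
-- new U-vertex of degree d.  Since deg(u) < (⌊deg(u)/d⌋ + 1)·d, there are at
-- least (e - n·d)/d ≥ n chunks; the first n of them form a graph G with
-- |U(G)| = |V(G)| = n, all U-degrees equal to d.  G avoids P because any copy
-- of P in G projects to a copy in G₀: two consecutive vertices of U(P) have a
-- common neighbour, so they can not come from disjoint chunks of the same
-- vertex of G₀, hence their projections are strictly increasing.

open import Defs
open import Data.Nat using (ℕ; suc; _*_)
open import Data.Nat.DivMod using (_/_)
open import Data.Fin using (Fin)
open import Data.Product using (∃; _×_)
open import Relation.Binary.PropositionalEquality using (_≡_)

open import Data.Bool using (Bool; true; false; if_then_else_; _∧_; not)
open import Data.Bool.Properties using (∧-zeroʳ)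
open import Data.Empty using (⊥; ⊥-elim)
open import Data.Fin as Fin using (zero; suc; toℕ; inject₁; inject≤)
import Data.Fin.Properties as Finₚ
open import Data.List using (List; []; _∷_; map; concat; length; lookup; tabulate; allFin)
open import Data.List.Membership.Propositional.Properties using (∈-lookup)
open import Data.List.Properties using (length-map; length-++; length-tabulate; map-tabulate)
open import Data.List.Relation.Unary.All as All using (All; []; _∷_)
import Data.List.Relation.Unary.All.Properties as Allₚ
open import Data.List.Relation.Unary.AllPairs as AllPairs using (AllPairs; []; _∷_)
import Data.List.Relation.Unary.AllPairs.Properties as AllPairsₚ
open import Data.Nat using (zero; _+_; _⊓_; _≤_; _<_; z≤n; s≤s; NonZero)
open import Data.Nat.DivMod using (_%_; m≡m%n+[m/n]*n; m%n<n; m/n*n≤m)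
open import Data.Nat.ListAction using (sum)
open import Data.Nat.Properties
open import Data.Nat.Tactic.RingSolver using (solve-∀)
open import Algebra.Properties.CommutativeSemigroup +-commutativeSemigroup using (interchange)
open import Data.Vec.Functional using (Vector; tail)
open import Data.Product using (_,_; proj₁; proj₂)
open import Data.Sum using (_⊎_; inj₁; inj₂)
open import Relation.Binary.PropositionalEquality using (refl; sym; trans; cong; cong₂; subst; subst₂; module ≡-Reasoning)

Row : ℕ → Set
Row k = Vector Bool k

_⊆_ : {k : ℕ} → Row k → Row k → Set
p ⊆ r = ∀ v → p v ≡ true → r v ≡ true

Disjoint : {k : ℕ} → Row k → Row k → Set
Disjoint p q = ∀ v → p v ≡ true → q v ≡ true → ⊥

_∖_ : {k : ℕ} → Row k → Row k → Row k
(r ∖ p) v = r v ∧ not (p v)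

ind : Bool → ℕ
ind b = if b then 1 else 0

-- The number of elements of a row; on Fin (suc k) it unfolds to
-- ind (r zero) + count (tail r).
count : {k : ℕ} → Row k → ℕ
count {k} r = sum (tabulate {n = k} (λ v → ind (r v)))

degU≡count : {m k : ℕ} (G : OBG m k) (u : Fin m) → degU G u ≡ count (G u)
degU≡count G u = cong sum (map-tabulate (λ v → v) (λ v → ind (G u v)))

count-empty : (k : ℕ) → count {k} (λ _ → false) ≡ 0
count-empty zero = refl
count-empty (suc k) = count-empty k

⊆-trans : {k : ℕ} {p q r : Row k} → p ⊆ q → q ⊆ r → p ⊆ r
⊆-trans p⊆q q⊆r v p∋v = q⊆r v (p⊆q v p∋v)

∖-⊆ : {k : ℕ} (r p : Row k) → (r ∖ p) ⊆ r
∖-⊆ r p v h with r v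
... | true = refl

∖-disjoint : {k : ℕ} (r p : Row k) → Disjoint p (r ∖ p)
∖-disjoint r p v p∋v r∖p∋v rewrite p∋v | ∧-zeroʳ (r v) with r∖p∋v
... | ()

count-∖ : {k : ℕ} (p r : Row k) → p ⊆ r → count p + count (r ∖ p) ≡ count r
count-∖ {zero} p r p⊆r = refl
count-∖ {suc k} p r p⊆r = begin
    (ind (p zero) + count (tail p)) + (ind ((r ∖ p) zero) + count (tail r ∖ tail p))
  ≡⟨ interchange (ind (p zero)) (count (tail p)) _ _ ⟩
    (ind (p zero) + ind ((r ∖ p) zero)) + (count (tail p) + count (tail r ∖ tail p))
  ≡⟨ cong₂ _+_ (ind-split (p zero) (r zero) (p⊆r zero)) (count-∖ (tail p) (tail r) (λ v → p⊆r (suc v))) ⟩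
    ind (r zero) + count (tail r)
  ∎
  where
  open ≡-Reasoning
  ind-split : ∀ a b → (a ≡ true → b ≡ true) → ind a + ind (b ∧ not a) ≡ ind b
  ind-split false false _ = refl
  ind-split false true _ = refl
  ind-split true b a⇒b rewrite a⇒b refl = refl

firstOnes : {k : ℕ} → ℕ → Row k → Row k
firstOnes zero r v = false
firstOnes (suc d) r zero = r zero
firstOnes (suc d) r (suc v) = firstOnes (if r zero then d else suc d) (tail r) v

firstOnes-⊆ : {k : ℕ} (d : ℕ) (r : Row k) → firstOnes d r ⊆ r
firstOnes-⊆ (suc d) r zero r∋0 = r∋0
firstOnes-⊆ (suc d) r (suc v) = firstOnes-⊆ (if r zero then d else suc d) (tail r) v

count-firstOnes : {k : ℕ} (d : ℕ) (r : Row k) → count (firstOnes d r) ≡ d ⊓ count r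
count-firstOnes {k} zero r = count-empty k
count-firstOnes {zero} (suc d) r = refl
count-firstOnes {suc k} (suc d) r with r zero
... | true = cong suc (count-firstOnes d (tail r))
... | false = count-firstOnes (suc d) (tail r)

chunks : {k : ℕ} → ℕ → ℕ → Row k → List (Row k)
chunks d zero r = []
chunks d (suc j) r = firstOnes d r ∷ chunks d j (r ∖ firstOnes d r)

length-chunks : {k : ℕ} (d j : ℕ) (r : Row k) → length (chunks d j r) ≡ j
length-chunks d zero r = refl
length-chunks d (suc j) r = cong suc (length-chunks d j (r ∖ firstOnes d r))

-- The chunks are parts of r, pairwise disjoint since each chunk is disjoint
-- from the remainder from which all later chunks are cut.
chunks-⊆ : {k : ℕ} (d j : ℕ) (r : Row k) → All (_⊆ r) (chunks d j r)
chunks-⊆ d zero r = []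
chunks-⊆ d (suc j) r = firstOnes-⊆ d r
  ∷ All.map (λ q⊆rest → ⊆-trans q⊆rest (∖-⊆ r (firstOnes d r))) (chunks-⊆ d j (r ∖ firstOnes d r))

chunks-disjoint : {k : ℕ} (d j : ℕ) (r : Row k) → AllPairs Disjoint (chunks d j r)
chunks-disjoint d zero r = []
chunks-disjoint d (suc j) r =
  All.map (λ q⊆rest v p∋v q∋v → ∖-disjoint r (firstOnes d r) v p∋v (q⊆rest v q∋v))
          (chunks-⊆ d j (r ∖ firstOnes d r))
  ∷ chunks-disjoint d j (r ∖ firstOnes d r)

chunks-size : {k : ℕ} (d j : ℕ) (r : Row k) → j * d ≤ count r → All (λ q → count q ≡ d) (chunks d j r)
chunks-size d zero r _ = []
chunks-size d (suc j) r jd≤r = count-first ∷ chunks-size d j rest (+-cancelˡ-≤ d _ _ jd≤d+rest)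
  where
  rest = r ∖ firstOnes d r
  count-first : count (firstOnes d r) ≡ d
  count-first = trans (count-firstOnes d r) (m≤n⇒m⊓n≡m (≤-trans (m≤m+n d (j * d)) jd≤r))
  jd≤d+rest : d + j * d ≤ d + count rest
  jd≤d+rest = begin
    d + j * d                             ≤⟨ jd≤r ⟩
    count r                               ≡⟨ count-∖ (firstOnes d r) r (firstOnes-⊆ d r) ⟨
    count (firstOnes d r) + count rest    ≡⟨ cong (_+ count rest) count-first ⟩
    d + count rest                        ∎
    where open ≤-Reasoning

increasing-from-steps : {p n : ℕ} (h : Fin (suc p) → Fin n) →
  (∀ i → h (inject₁ i) Fin.< h (suc i)) → StrictlyIncreasing h
increasing-from-steps h step zero (suc zero) _ = step zero
increasing-from-steps {suc p} h step zero (suc (suc j)) _ =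
  Finₚ.<-trans (step zero) (increasing-from-steps (λ i → h (suc i)) (λ i → step (suc i)) zero (suc j) (s≤s z≤n))
increasing-from-steps {suc p} h step (suc i) (suc j) (s≤s i<j) =
  increasing-from-steps (λ i → h (suc i)) (λ i → step (suc i)) i j i<j

ConsecutiveCommonNeighbour : {p q : ℕ} → OBG (suc p) q → Set
ConsecutiveCommonNeighbour {p} P = ∀ (i : Fin p) → ∃ λ b → P (inject₁ i) b ≡ true × P (suc i) b ≡ true

-- A vertex of a split graph: the vertex of G it comes from, and its neighbourhood.
SplitVertex : ℕ → ℕ → Set
SplitVertex m k = Fin m × Row k

Precedes : {m k : ℕ} → SplitVertex m k → SplitVertex m k → Set
Precedes (u , p) (u' , q) = u Fin.< u' ⊎ (u ≡ u' × Disjoint p q)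

record Splitting {m m' k : ℕ} (G : OBG m k) (G' : OBG m' k) : Set where
  field
    origin : Fin m' → Fin m
    rows-⊆ : ∀ x → G' x ⊆ G (origin x)
    ordered : ∀ x y → x Fin.< y → Precedes (origin x , G' x) (origin y , G' y)

-- Splitting preserves avoidance of patterns with consecutive common neighbours:
-- a copy of P in G' projects along origin to a copy of P in G.
splitting-avoids : {m m' k p q : ℕ} {G : OBG m k} {G' : OBG m' k} {P : OBG (suc p) q} →
  ConsecutiveCommonNeighbour P → Splitting G G' → Avoids G P → Avoids G' P
splitting-avoids common split G-avoids (f , g , f↑ , g↑ , edges) =
  G-avoids ((λ i → origin (f i)) , g , increasing-from-steps (λ i → origin (f i)) step , g↑ ,
            λ i j P∋ij → rows-⊆ (f i) (g j) (edges i j P∋ij))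
  where
  open Splitting split
  step : ∀ i → origin (f (inject₁ i)) Fin.< origin (f (suc i))
  step i with ordered (f (inject₁ i)) (f (suc i)) (f↑ _ _ (Finₚ.≤̄⇒inject₁< Finₚ.≤-refl)) | common i
  ... | inj₁ lt | _ = lt
  ... | inj₂ (_ , disjoint) | b , P∋ib , P∋i+1b = ⊥-elim (disjoint (g b) (edges _ b P∋ib) (edges _ b P∋i+1b))

IsChunk : {m k : ℕ} → OBG m k → ℕ → SplitVertex m k → Set
IsChunk G d (u , q) = count q ≡ d × q ⊆ G u

AllPairs-lookup : {A : Set} {R : A → A → Set} {xs : List A} → AllPairs R xs →
  {i j : Fin (length xs)} → toℕ i < toℕ j → R (lookup xs i) (lookup xs j)
AllPairs-lookup (Rx ∷ _) {zero} {suc j} _ = All.lookup Rx (∈-lookup j)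
AllPairs-lookup (_ ∷ Rxs) {suc i} {suc j} (s≤s i<j) = AllPairs-lookup Rxs i<j

splitting-from-list : {m m' k d : ℕ} (G : OBG m k) (L : List (SplitVertex m k)) →
  All (IsChunk G d) L → AllPairs Precedes L → m' ≤ length L →
  ∃ λ (G' : OBG m' k) → Splitting G G' × (∀ x → degU G' x ≡ d)
splitting-from-list {m} {m'} {k} {d} G L chunks ordered m'≤L = G' , splitting , degrees
  where
  vertex : Fin m' → SplitVertex m k
  vertex x = lookup L (inject≤ x m'≤L)
  G' : OBG m' k
  G' x = proj₂ (vertex x)
  is-chunk : ∀ x → IsChunk G d (vertex x)
  is-chunk x = All.lookup chunks (∈-lookup (inject≤ x m'≤L))
  splitting : Splitting G G'
  splitting = record
    { origin = λ x → proj₁ (vertex x)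
    ; rows-⊆ = λ x → proj₂ (is-chunk x)
    ; ordered = λ x y x<y → AllPairs-lookup ordered
        (subst₂ _<_ (sym (Finₚ.toℕ-inject≤ x m'≤L)) (sym (Finₚ.toℕ-inject≤ y m'≤L)) x<y)
    }
  degrees : ∀ x → degU G' x ≡ d
  degrees x = trans (degU≡count G' x) (proj₁ (is-chunk x))

≤/*+ : ∀ c d .{{_ : NonZero d}} → c ≤ c / d * d + d
≤/*+ c d = begin
    c                  ≡⟨ m≡m%n+[m/n]*n c d ⟩
    c % d + c / d * d  ≤⟨ +-monoˡ-≤ (c / d * d) (<⇒≤ (m%n<n c d)) ⟩
    d + c / d * d      ≡⟨ +-comm d (c / d * d) ⟩
    c / d * d + d      ∎
  where open ≤-Reasoning

module ChunkSplitting {m k : ℕ} (G : OBG m k) (d : ℕ) .{{_ : NonZero d}} where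

  pieces : Fin m → List (SplitVertex m k)
  pieces u = map (u ,_) (chunks d (count (G u) / d) (G u))

  splitVertices : List (SplitVertex m k)
  splitVertices = concat (map pieces (allFin m))

  pieces-chunks : ∀ u → All (IsChunk G d) (pieces u)
  pieces-chunks u = Allₚ.map⁺ (All.zip (chunks-size d _ (G u) (m/n*n≤m _ d) , chunks-⊆ d _ (G u)))

  pieces-ordered : ∀ u → AllPairs Precedes (pieces u)
  pieces-ordered u = AllPairsₚ.map⁺ (AllPairs.map (λ disjoint → inj₂ (refl , disjoint)) (chunks-disjoint d _ (G u)))

  pieces-before : ∀ {u u'} → u Fin.< u' → All (λ x → All (Precedes x) (pieces u')) (pieces u)
  pieces-before u<u' = Allₚ.map⁺ (All.universal (λ _ → Allₚ.map⁺ (All.universal (λ _ → inj₁ u<u') _)) _)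

  splitVertices-chunks : All (IsChunk G d) splitVertices
  splitVertices-chunks = Allₚ.concat⁺ (Allₚ.map⁺ (Allₚ.tabulate⁺ pieces-chunks))

  splitVertices-ordered : AllPairs Precedes splitVertices
  splitVertices-ordered = AllPairsₚ.concat⁺ (Allₚ.map⁺ (Allₚ.tabulate⁺ pieces-ordered))
    (AllPairsₚ.map⁺ (AllPairsₚ.tabulate⁺-< pieces-before))

  -- Each vertex loses fewer than d edges by the splitting.
  degU-≤ : ∀ u → degU G u ≤ length (pieces u) * d + d
  degU-≤ u rewrite degU≡count G u | length-map (u ,_) (chunks d (count (G u) / d) (G u))
                 | length-chunks d (count (G u) / d) (G u) = ≤/*+ (count (G u)) d

  degree-sum-≤ : ∀ us → sum (map (degU G) us) ≤ length (concat (map pieces us)) * d + length us * d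
  degree-sum-≤ [] = z≤n
  degree-sum-≤ (u ∷ us) = begin
      degU G u + sum (map (degU G) us)
    ≤⟨ +-mono-≤ (degU-≤ u) (degree-sum-≤ us) ⟩
      (a * d + d) + (b * d + length us * d)
    ≡⟨ regroup a b (length us) d ⟩
      (a + b) * d + suc (length us) * d
    ≡⟨ cong (λ l → l * d + suc (length us) * d) (sym (length-++ (pieces u))) ⟩
      length (concat (map pieces (u ∷ us))) * d + length (u ∷ us) * d
    ∎
    where
    open ≤-Reasoning
    a = length (pieces u)
    b = length (concat (map pieces us))
    regroup : ∀ a b l d → (a * d + d) + (b * d + l * d) ≡ (a + b) * d + suc l * d
    regroup = solve-∀

  edgeCount-≤ : edgeCount G ≤ length splitVertices * d + m * d
  edgeCount-≤ = subst (λ l → edgeCount G ≤ length splitVertices * d + l * d)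
                      (length-tabulate {n = m} (λ u → u)) (degree-sum-≤ (allFin m))

regular-splitting : {m k : ℕ} (m' : ℕ) (G : OBG m k) (d : ℕ) .{{_ : NonZero d}} →
  (m' + m) * d ≤ edgeCount G →
  ∃ λ (G' : OBG m' k) → Splitting G G' × (∀ x → degU G' x ≡ d)
regular-splitting {m} m' G d enough-edges =
  splitting-from-list G splitVertices splitVertices-chunks splitVertices-ordered m'≤L
  where
  open ChunkSplitting G d
  m'≤L : m' ≤ length splitVertices
  m'≤L = *-cancelʳ-≤ m' (length splitVertices) d (+-cancelʳ-≤ (m * d) (m' * d) (length splitVertices * d)
           (begin
             m' * d + m * d                     ≡⟨ *-distribʳ-+ d m' m ⟨
             (m' + m) * d                       ≤⟨ enough-edges ⟩
             edgeCount G                        ≤⟨ edgeCount-≤ ⟩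
             length splitVertices * d + m * d   ∎))
    where open ≤-Reasoning

enough-edges : {m : ℕ} (G : OBG m m) (k : ℕ) {d e : ℕ} → e / (2 * suc k) ≡ d → edgeCount G ≡ e →
  (suc k + suc k) * d ≤ edgeCount G
enough-edges G k {e = e} refl refl = begin
    (n + n) * (e / (2 * n))  ≡⟨ cong (λ c → (n + c) * (e / (2 * n))) (+-identityʳ n) ⟨
    (2 * n) * (e / (2 * n))  ≡⟨ *-comm (2 * n) (e / (2 * n)) ⟩
    e / (2 * n) * (2 * n)    ≤⟨ m/n*n≤m e (2 * n) ⟩
    e                        ∎
  where
  open ≤-Reasoning
  n = suc k

emptyGraph : {m k : ℕ} → OBG m k
emptyGraph _ _ = false

degU-empty : {m k : ℕ} (u : Fin m) → degU (emptyGraph {m} {k}) u ≡ 0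
degU-empty {m} {k} u = trans (degU≡count (emptyGraph {m} {k}) u) (count-empty k)

empty-avoids : {m k p q : ℕ} (P : OBG p q) (a : Fin p) (b : Fin q) → P a b ≡ true →
  Avoids (emptyGraph {m} {k}) P
empty-avoids P a b P∋ab (f , g , _ , _ , edges) with edges a b P∋ab
... | ()

-- In P43, a₁,a₂ share the neighbour b₁ and a₂,a₃ share b₄.
P43-common : ConsecutiveCommonNeighbour P43
P43-common zero = zero , refl , refl
P43-common (suc zero) = suc (suc (suc zero)) , refl , refl

lemma4p3 : (k : ℕ) → (e : ℕ) → IsEx2 (suc k) P43 e →
    ∃ λ (G : OBG (suc k) (suc k)) →
    Avoids G P43 × (∀ (u : Fin (suc k)) → degU G u ≡ e / (2 * suc k))
lemma4p3 k e ((G₀ , G₀-avoids , G₀-edges) , _) with e / (2 * suc k) in e/2n≡d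
... | zero = emptyGraph , empty-avoids P43 zero zero refl , degU-empty {k = suc k}
... | suc d =
  let G , splitting , degrees = regular-splitting (suc k) G₀ (suc d) (enough-edges G₀ k e/2n≡d G₀-edges)
  in G , splitting-avoids P43-common splitting G₀-avoids , degrees
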